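{- Let $p$ be a prime and let $(\Omega,S)$ be a coherent configuration with fibers $\Omega_1,\dots,\Omega_m$ such that $(\Omega_i,S_i)\simeq C_p\wr C_p$ for each $i$. Let $s\in S_{ij}$ be non-regular with $n_s=p$. Then $\sigma_s\sigma_{s^\ast}=p\sigma_{1_{\Omega_i}}+\sum_{u\in S_i\setminus\mathbf{O}_\theta(S_i)}\sigma_u$ and $\sigma_{s^\ast}\sigma_s=p\sigma_{1_{\Omega_j}}+\sum_{u\in S_j\setminus\mathbf{O}_\theta(S_j)}\sigma_u$.
   Context: A coherent configuration is a pair $(\Omega,S)$ of a finite set $\Omega$ and a partition $S$ of $\Omega\times\Omega$ such that $1_\Omega$ is a union of elements of $S$, $s^\ast:=\{(\beta,\alpha)\mid(\alpha,\beta)\in s\}\in S$ for $s\in S$, and $\sigma_s\sigma_t=\sum_{u\in S}c_{st}^u\sigma_u$ with nonnegative integers $c_{st}^u$, where $\sigma_u$ is the $\Omega\times\Omega$ adjacency matrix of $u$. Fibers are the sets $\Delta$ with $1_\Delta\in S$; they partition $\Omega$. $S_{ij}:=\{s\in S\mid s\subseteq\Omega_i\times\Omega_j\}$, $S_i:=S_{ii}$. For $s\in S_{ij}$, $n_s:=|\{\beta\mid(\alpha,\beta)\in s\}|$ for any $\alpha\in\Omega_i$. $\mathbf{O}_\theta(S_i):=\{t\in S_i\mid n_t=1\}$. The complex product of $T,U\subseteq S$ is $TU:=\{s\mid c_{tu}^s>0$ for some $t\in T,u\in U\}$, singletons written without braces. An element $s\in S$ is regular if $ss^\ast s=\{s\}$.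 $C_p\wr C_p$ is the association scheme on $\mathbb{Z}_p\times\mathbb{Z}_p$ with relations $\{((x,y),(x+a,y))\}$ ($a\in\mathbb{Z}_p$) and $\{((x_1,y),(x_2,y+b))\}$ ($b\ne0$). -}

module Defs where

open import Data.Nat using (ℕ; zero; suc; _+_; _*_; _∸_; _≤ᵇ_; _≡ᵇ_)
open import Data.Bool using (Bool; true; false; if_then_else_; _∧_; _∨_; not)
open import Data.Fin using (Fin; toℕ)
open import Data.Fin.Properties using (_≟_)
open import Data.List using (List; map; allFin)
open import Data.Nat.ListAction using (sum)
open import Data.Bool.ListAction using (all)
open import Data.Product using (Σ; ∃; _×_; _,_; proj₁; proj₂)
open import Data.Sum using (_⊎_; inj₁; inj₂)
open import Relation.Nullary using (¬_)
open import Relation.Nullary.Decidable using (⌊_⌋)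
open import Relation.Binary.PropositionalEquality using (_≡_)
open import Function.Bundles using (_⤖_; _⇔_; Bijection)

countF : ∀ {N} → (Fin N → Bool) → ℕ
countF {N} P = sum (map (λ z → if P z then 1 else 0) (allFin N))

sumF : ∀ {N} → (Fin N → ℕ) → ℕ
sumF {N} f = sum (map f (allFin N))

_=ᶠ_ : ∀ {n} → Fin n → Fin n → Bool
a =ᶠ b = ⌊ a ≟ b ⌋

-- Coherent configurations on Ω = Fin N with r basis relations.
-- The partition S of Ω×Ω is given by a colouring c : Ω → Ω → Fin r;
-- the basis relation with label s is { (α,β) | c α β ≡ s }.

record CoherentConfiguration (N r : ℕ) : Set where
  field
    col       : Fin N → Fin N → Fin r
    nonempty  : ∀ (s : Fin r) → Σ (Fin N) λ x → Σ (Fin N) λ y → col x y ≡ s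
    -- 1_Ω is a union of basis relations
    diagUnion : ∀ x y z → col x x ≡ col y z → y ≡ z
    -- s* ∈ S for s ∈ S
    transp    : ∀ x y x' y' → col x y ≡ col x' y' → col y x ≡ col y' x'
    -- σ_s σ_t = Σ_u c_{st}^u σ_u : the number of z with (x,z) ∈ s, (z,y) ∈ t
    -- depends only on the basis relation containing (x,y)
    constants : ∀ (s t : Fin r) x y x' y' → col x y ≡ col x' y' →
                countF (λ z → (col x z =ᶠ s) ∧ (col z y =ᶠ t))
                ≡ countF (λ z → (col x' z =ᶠ s) ∧ (col z y' =ᶠ t))

module CC {N r : ℕ} (X : CoherentConfiguration N r) where
  open CoherentConfiguration X public

  _* : Fin r → Fin r
  s * = col (proj₁ (proj₂ (nonempty s))) (proj₁ (nonempty s))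

  -- d is (the label of) 1_Δ for a fiber Δ
  IsFiber : Fin r → Set
  IsFiber d = Σ (Fin N) λ x → col x x ≡ d

  InFiber : Fin r → Fin N → Set
  InFiber d x = col x x ≡ d

  -- s ∈ S_{ij} (i, j given by the labels of 1_{Ω_i}, 1_{Ω_j})
  InS : Fin r → Fin r → Fin r → Set
  InS s i j = ∀ x y → col x y ≡ s → InFiber i x × InFiber j y

  inSᵇ : Fin r → Fin r → Fin r → Bool
  inSᵇ u i j = all (λ x → all (λ y →
                 not (col x y =ᶠ u) ∨ ((col x x =ᶠ i) ∧ (col y y =ᶠ j)))
                 (allFin N)) (allFin N)

  ValencyIs : Fin r → Fin r → ℕ → Set
  ValencyIs s i k = ∀ α → InFiber i α → countF (λ β → col α β =ᶠ s) ≡ k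

  -- boolean: n_u = 1 for u ∈ S_i  (i.e. u ∈ O_θ(S_i))
  thinᵇ : Fin r → Fin r → Bool
  thinᵇ u i = all (λ α → not (col α α =ᶠ i) ∨ (countF (λ β → col α β =ᶠ u) ≡ᵇ 1))
                  (allFin N)

  σ : Fin r → Fin N → Fin N → ℕ
  σ u x y = if col x y =ᶠ u then 1 else 0

  _·_ : (Fin N → Fin N → ℕ) → (Fin N → Fin N → ℕ) → Fin N → Fin N → ℕ
  (A · B) x y = sumF (λ z → A x z * B z y)

  σNonThin : Fin r → Fin N → Fin N → ℕ
  σNonThin i x y = sumF (λ u → if inSᵇ u i i ∧ not (thinᵇ u i) then σ u x y else 0)

  -- c_{st}^u > 0 (c_{st}^u is the common value of the count at any (x,y) ∈ u)
  ProdPos : Fin r → Fin r → Fin r → Set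
  ProdPos s t u = Σ (Fin N) λ x → Σ (Fin N) λ y → col x y ≡ u ×
                  Σ (Fin N) λ z → col x z ≡ s × col z y ≡ t

  InSSS : Fin r → Fin r → Set
  InSSS s u = Σ (Fin r) λ t → ProdPos s (s *) t × ProdPos t s u

  Regular : Fin r → Set
  Regular s = ∀ u → (InSSS s u → u ≡ s) × (u ≡ s → InSSS s u)

subMod : (p : ℕ) → Fin p → Fin p → ℕ
subMod p a b = if toℕ b ≤ᵇ toℕ a then toℕ a ∸ toℕ b else toℕ a + p ∸ toℕ b

-- colour of ((x₁,y₁),(x₂,y₂)):  inj₁ a  for ((x,y),(x+a,y)),
--                               inj₂ b  for ((x₁,y),(x₂,y+b)), b ≠ 0
wreathCol : (p : ℕ) → Fin p × Fin p → Fin p × Fin p → ℕ ⊎ ℕ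
wreathCol p (x₁ , y₁) (x₂ , y₂) =
  if y₁ =ᶠ y₂ then inj₁ (subMod p x₂ x₁) else inj₂ (subMod p y₂ y₁)

-- (Ω_d, S_d) ≃ C_p ≀ C_p : a bijection Ω_d → ℤ_p × ℤ_p mapping the
-- partition S_d onto the partition of C_p ≀ C_p
module _ {N r : ℕ} (X : CoherentConfiguration N r) where
  open CoherentConfiguration X

  Fiber : Fin r → Set
  Fiber d = Σ (Fin N) λ x → col x x ≡ d

  IsoWreath : ℕ → Fin r → Set
  IsoWreath p d =
    Σ (Fiber d ⤖ (Fin p × Fin p)) λ f →
      let g = Bijection.to f in
      ∀ (a b a' b' : Fiber d) →
        (col (proj₁ a) (proj₁ b) ≡ col (proj₁ a') (proj₁ b'))
        ⇔ (wreathCol p (g a) (g b) ≡ wreathCol p (g a') (g b'))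

{-
For a fiber Ω_d ≅ C_p ≀ C_p call the p rows of ℤ_p × ℤ_p its blocks. The thin relations of S_d are
those inside a block, and a relation between different blocks is determined by the pair of blocks.

Let s ∈ S_ij with n_s = p. Since lying in a common block is a thin relation, the number k of
s-neighbours of x in a fixed block of Ω_j is a sum of structure constants, independent of the pair
(x, a) ∈ s, and summing over the blocks gives k ∣ p. For k = p the neighbours of x would form a
whole block and s s* s = {s}; so k = 1: the s-neighbours of a point lie in distinct blocks. Counting
s from both ends (both fibers have p² points) gives n_{s*} = p.

Double counting over a block shows that points of Ω_j in different blocks have exactly one common
s*-neighbour. This forbids distinct points of one block of Ω_i to share an s-neighbour, and then the
same double counting gives exactly one common s-neighbour to points of Ω_i in different blocks.
With p on the diagonal this is the claimed product, the non-thin relations of S_i being those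
between different blocks.
-}
module Submission where

open import Data.Nat using (ℕ; zero; suc; _+_; _*_; _≤_; _<_; _≤ᵇ_; _≡ᵇ_; z≤n; s≤s;
  NonZero; NonTrivial; >-nonZero; nonTrivial⇒n>1; nonTrivial⇒nonZero)
open import Data.Nat.Properties using (≤-refl; ≤-reflexive; ≤-trans; ≤-antisym; ≤-pred; <⇒≤; <⇒≱; 1+n≰n;
  m≤n+m; m+n≮n; +-mono-≤; +-mono-≤-<; +-comm; +-identityʳ; *-identityʳ; *-zeroʳ; *-suc; m∸n+n≡m;
  +-cancelʳ-≡; *-cancelʳ-≡; m*n≢0; ≤ᵇ⇒≤; ≡ᵇ⇒≡; ≡⇒≡ᵇ; +-*-semiring; +-commutativeSemigroup)
open import Data.Nat.Divisibility using (_∣_; ∣-refl; _∣0; ∣m∣n⇒∣m+n)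
open import Data.Nat.Primality using (Prime; prime⇒nonTrivial; prime⇒irreducible)
import Data.Nat.ListAction as List
open import Data.Bool using (Bool; true; false; if_then_else_; _∧_; _∨_; not; T)
open import Data.Bool.ListAction using (all)
open import Data.Bool.Properties using (T-∧; T-≡; T-irrelevant; ∧-zeroʳ; ∧-identityʳ; ∧-idem; ∧-commutativeMonoid)
open import Data.Fin using (Fin; zero; suc; toℕ; punchIn)
open import Data.Fin.Properties using (_≟_; suc-injective; 0≢1+n; toℕ<n; toℕ-injective; punchInᵢ≢i;
  0↔⊥; 1↔⊤; +↔⊎; cantor-schröder-bernstein)
open import Data.List using (map; tabulate; allFin)
open import Data.Product using (Σ-syntax; _×_; _,_; proj₁; proj₂)
open import Data.Product.Properties using (×-≡,≡→≡)
open import Data.Sum using (_⊎_; inj₁; inj₂)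
import Data.Sum as Sum
open import Data.Sum.Properties using (inj₁-injective)
open import Data.Sum.Function.Propositional using (_⊎-↔_)
open import Data.Empty using (⊥; ⊥-elim)
open import Data.Unit using (tt)
open import Relation.Nullary using (¬_; Dec; yes; no; contradiction; _×-dec_)
open import Relation.Nullary.Decidable using (⌊⌋-map′; isYes≗does; decidable-stable; dec-true; dec-false;
  toWitness; fromWitness)
open import Relation.Binary.PropositionalEquality using (_≡_; _≢_; refl; sym; trans; cong; cong₂; subst;
  module ≡-Reasoning)
open import Function using (_∘_; id; flip; case_of_; _⇔_; mk⇔; _↔_; mk↔ₛ′; Equivalence; Injection; Inverse)
open import Function.Construct.Composition using (_↔-∘_)
open import Function.Properties.Inverse using (↔-sym; ↔⇒↣)
open import Function.Properties.Bijection using (⤖⇒↔)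
open import Axiom.UniquenessOfIdentityProofs using (module Decidable⇒UIP)
open import Algebra.Bundles using (CommutativeMonoid)
open import Algebra.Properties.Semiring.Sum +-*-semiring using (sum; sum-cong-≗)
open import Algebra.Properties.CommutativeSemigroup +-commutativeSemigroup using (interchange)
open import Algebra.Properties.CommutativeSemigroup (CommutativeMonoid.commutativeSemigroup ∧-commutativeMonoid)
  using () renaming (x∙yz≈y∙xz to ∧-exchange)

open import Defs

≡⇒=ᶠ : ∀ {n} {a b : Fin n} → a ≡ b → (a =ᶠ b) ≡ true
≡⇒=ᶠ {a = a} {b} a≡b = trans (isYes≗does (a ≟ b)) (dec-true (a ≟ b) a≡b)

≢⇒=ᶠ : ∀ {n} {a b : Fin n} → a ≢ b → (a =ᶠ b) ≡ false
≢⇒=ᶠ {a = a} {b} a≢b = trans (isYes≗does (a ≟ b)) (dec-false (a ≟ b) a≢b)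

T-=ᶠ∧=ᶠ : ∀ {m n} {a b : Fin m} {c e : Fin n} → T ((a =ᶠ b) ∧ (c =ᶠ e)) ⇔ (a ≡ b × c ≡ e)
T-=ᶠ∧=ᶠ {a = a} {b} {c} {e} = mk⇔
  (λ h → let h₁ , h₂ = Equivalence.to (T-∧ {a =ᶠ b} {c =ᶠ e}) h in toWitness h₁ , toWitness h₂)
  (λ (a≡b , c≡e) → Equivalence.from (T-∧ {a =ᶠ b} {c =ᶠ e}) (fromWitness a≡b , fromWitness c≡e))

=ᶠ-suc : ∀ {n} (a b : Fin n) → (suc a =ᶠ suc b) ≡ (a =ᶠ b)
=ᶠ-suc a b = ⌊⌋-map′ (cong suc) suc-injective (a ≟ b)

¬T⇒≡false : ∀ {b} → ¬ T b → b ≡ false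
¬T⇒≡false {false} _  = refl
¬T⇒≡false {true}  ¬b = ⊥-elim (¬b tt)

T-not∨ : ∀ {b c} → T (not b ∨ c) ⇔ (T b → T c)
T-not∨ {true}  = mk⇔ (λ c _ → c) (λ b⇒c → b⇒c tt)
T-not∨ {false} = mk⇔ (λ _ ()) (λ _ → tt)

T-⇔⇒≡ : ∀ {b c} → T b ⇔ T c → b ≡ c
T-⇔⇒≡ {false} {false} _   = refl
T-⇔⇒≡ {false} {true}  b⇔c = ⊥-elim (Equivalence.from b⇔c tt)
T-⇔⇒≡ {true}  {false} b⇔c = ⊥-elim (Equivalence.to b⇔c tt)
T-⇔⇒≡ {true}  {true}  _   = refl

if-T : ∀ {A : Set} {b} {x y : A} → T b → (if b then x else y) ≡ x
if-T {b = true} _ = refl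

if-¬T : ∀ {A : Set} {b} {x y : A} → ¬ T b → (if b then x else y) ≡ y
if-¬T {b = false} _  = refl
if-¬T {b = true}  ¬b = ⊥-elim (¬b tt)

∧-congˡ-T : ∀ {a b c} → (T a → b ≡ c) → (a ∧ b) ≡ (a ∧ c)
∧-congˡ-T {true}  b≡c = b≡c tt
∧-congˡ-T {false} _   = refl

T-all-allFin : ∀ {N} (f : Fin N → Bool) → T (all f (allFin N)) ⇔ (∀ z → T (f z))
T-all-allFin f = go f id
  where
  go : ∀ {A : Set} {N} (f : A → Bool) (g : Fin N → A) → T (all f (tabulate g)) ⇔ (∀ z → T (f (g z)))
  go {N = zero}  f g = mk⇔ (λ _ ()) (λ _ → tt)
  go {N = suc N} f g = mk⇔
    (λ h → let h₀ , hₛ = Equivalence.to T-∧ h in λ { zero → h₀ ; (suc z) → Equivalence.to (go f (g ∘ suc)) hₛ z })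
    (λ h → Equivalence.from T-∧ (h zero , Equivalence.from (go f (g ∘ suc)) (h ∘ suc)))

𝟙 : Bool → ℕ
𝟙 b = if b then 1 else 0

𝟙-mono : ∀ {b c} → (T b → T c) → 𝟙 b ≤ 𝟙 c
𝟙-mono {false}         _   = z≤n
𝟙-mono {true}  {true}  _   = ≤-refl
𝟙-mono {true}  {false} b⇒c = ⊥-elim (b⇒c tt)

count : ∀ {N} → (Fin N → Bool) → ℕ
count P = sum (𝟙 ∘ P)


-- Finite sums
sumF≡sum : ∀ {N} (f : Fin N → ℕ) → sumF f ≡ sum f
sumF≡sum f = go f id
  where
  go : ∀ {A : Set} {N} (f : A → ℕ) (g : Fin N → A) → List.sum (map f (tabulate g)) ≡ sum (f ∘ g)
  go {N = zero}  f g = refl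
  go {N = suc N} f g = cong (f (g zero) +_) (go f (g ∘ suc))

countF≡count : ∀ {N} (P : Fin N → Bool) → countF P ≡ count P
countF≡count P = sumF≡sum (𝟙 ∘ P)

sum-zero : ∀ N → sum {N} (λ _ → 0) ≡ 0
sum-zero zero    = refl
sum-zero (suc N) = sum-zero N

sum-one : ∀ N → sum {N} (λ _ → 1) ≡ N
sum-one zero    = refl
sum-one (suc N) = cong suc (sum-one N)

sum-mono-≤ : ∀ {N} {f g : Fin N → ℕ} → (∀ z → f z ≤ g z) → sum f ≤ sum g
sum-mono-≤ {zero}  h = z≤n
sum-mono-≤ {suc N} h = +-mono-≤ (h zero) (sum-mono-≤ (h ∘ suc))

sum-distrib-+ : ∀ {N} (f g : Fin N → ℕ) → sum (λ z → f z + g z) ≡ sum f + sum g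
sum-distrib-+ {zero}  f g = refl
sum-distrib-+ {suc N} f g = begin
  (f zero + g zero) + sum (λ z → f (suc z) + g (suc z))
    ≡⟨ cong (f zero + g zero +_) (sum-distrib-+ (f ∘ suc) (g ∘ suc)) ⟩
  (f zero + g zero) + (sum (f ∘ suc) + sum (g ∘ suc))
    ≡⟨ interchange (f zero) (g zero) _ _ ⟩
  (f zero + sum (f ∘ suc)) + (g zero + sum (g ∘ suc)) ∎
  where open ≡-Reasoning

sum-swap : ∀ {N M} (f : Fin N → Fin M → ℕ) →
           sum (λ y → sum (λ z → f y z)) ≡ sum (λ z → sum (λ y → f y z))
sum-swap {zero}  {M} f = sym (sum-zero M)
sum-swap {suc N}     f = trans (cong (sum (f zero) +_) (sum-swap (f ∘ suc)))
                               (sym (sum-distrib-+ (f zero) (λ z → sum (λ y → f (suc y) z))))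

sum-if : ∀ {N} (P : Fin N → Bool) (c : ℕ) → sum (λ z → if P z then c else 0) ≡ c * count P
sum-if {zero}  P c = sym (*-zeroʳ c)
sum-if {suc N} P c with P zero
... | true  = trans (cong (c +_) (sum-if (P ∘ suc) c)) (sym (*-suc c _))
... | false = sum-if (P ∘ suc) c

sum-on : ∀ {N} (P : Fin N → Bool) {f : Fin N → ℕ} {c : ℕ} →
         (∀ z → T (P z) → f z ≡ c) → (∀ z → ¬ T (P z) → f z ≡ 0) → sum f ≡ c * count P
sum-on P {f} {c} on off = trans (sum-cong-≗ pointwise) (sum-if P c)
  where
  pointwise : ∀ z → f z ≡ (if P z then c else 0)
  pointwise z with P z in eq
  ... | true  = on z (subst T (sym eq) tt)
  ... | false = off z (subst T eq)

sum-delta : ∀ {M} (v : Fin M) (h : Fin M → ℕ) → sum (λ t → if v =ᶠ t then h t else 0) ≡ h v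
sum-delta {suc M} zero h rewrite sum-zero M = +-identityʳ (h zero)
sum-delta {suc M} (suc v) h = begin
  sum (λ t → if suc v =ᶠ suc t then h (suc t) else 0)
    ≡⟨ sum-cong-≗ (λ t → cong (λ b → if b then h (suc t) else 0) (=ᶠ-suc v t)) ⟩
  sum (λ t → if v =ᶠ t then h (suc t) else 0)
    ≡⟨ sum-delta v (h ∘ suc) ⟩
  h (suc v) ∎
  where open ≡-Reasoning

sum-≡0⊎k-divisible : ∀ {M} (f : Fin M → ℕ) (k : ℕ) → (∀ t → f t ≡ 0 ⊎ f t ≡ k) → k ∣ sum f
sum-≡0⊎k-divisible {zero}  f k h = k ∣0
sum-≡0⊎k-divisible {suc M} f k h with f zero | h zero
... | _ | inj₁ refl = sum-≡0⊎k-divisible (f ∘ suc) k (h ∘ suc)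
... | _ | inj₂ refl = ∣m∣n⇒∣m+n ∣-refl (sum-≡0⊎k-divisible (f ∘ suc) k (h ∘ suc))

sum≤1-≡M : ∀ {M} (f : Fin M → ℕ) → (∀ t → f t ≤ 1) → sum f ≡ M → ∀ t → f t ≡ 1
sum≤1-≡M {suc M} f f≤1 Σf≡sucM t = go t (split (f≤1 zero) (sum-≤ (f ∘ suc) (f≤1 ∘ suc)) Σf≡sucM)
  where
  sum-≤ : ∀ {K} (g : Fin K → ℕ) → (∀ t → g t ≤ 1) → sum g ≤ K
  sum-≤ {K} g g≤1 = subst (sum g ≤_) (sum-one K) (sum-mono-≤ g≤1)
  split : ∀ {a b} → a ≤ 1 → b ≤ M → a + b ≡ suc M → a ≡ 1 × b ≡ M
  split {0}           _        b≤M refl = contradiction b≤M 1+n≰n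
  split {1}           _        _   refl = refl , refl
  split {suc (suc _)} (s≤s ()) _   _
  go : ∀ t → f zero ≡ 1 × sum (f ∘ suc) ≡ M → f t ≡ 1
  go zero    (f0≡1 , _)  = f0≡1
  go (suc t) (_ , Σ≡M)   = sum≤1-≡M (f ∘ suc) (f≤1 ∘ suc) Σ≡M t


-- Counting
count-cong : ∀ {N} {P Q : Fin N → Bool} → (∀ z → P z ≡ Q z) → count P ≡ count Q
count-cong P≗Q = sum-cong-≗ (cong 𝟙 ∘ P≗Q)

count-mono : ∀ {N} {P Q : Fin N → Bool} → (∀ z → T (P z) → T (Q z)) → count P ≤ count Q
count-mono P⊆Q = sum-mono-≤ (λ z → 𝟙-mono (P⊆Q z))

count-none : ∀ {N} {P : Fin N → Bool} → (∀ z → ¬ T (P z)) → count P ≡ 0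
count-none {N} ¬P = trans (count-cong (λ z → ¬T⇒≡false (¬P z))) (sum-zero N)

count-∧-const : ∀ {N} (b : Bool) (P : Fin N → Bool) → count (λ z → b ∧ P z) ≡ (if b then count P else 0)
count-∧-const     true  P = refl
count-∧-const {N} false P = sum-zero N

count-∧-true : ∀ {N} {b : Bool} {P : Fin N → Bool} → T b → count (λ z → b ∧ P z) ≡ count P
count-∧-true {b = true} _ = refl

count-pos : ∀ {N} {P : Fin N → Bool} (z : Fin N) → T (P z) → 1 ≤ count P
count-pos {P = P} zero    Pz with P zero
... | true = s≤s z≤n
count-pos {P = P} (suc z) Pz = ≤-trans (count-pos {P = P ∘ suc} z Pz) (m≤n+m _ (𝟙 (P zero)))

count-witness : ∀ {N} {P : Fin N → Bool} → 1 ≤ count P → Σ[ z ∈ Fin N ] T (P z)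
count-witness {suc N} {P} 1≤ with P zero in eq
... | true  = zero , subst T (sym eq) tt
... | false = let z , Pz = count-witness {P = P ∘ suc} 1≤ in suc z , Pz

count≡0⊎witness : ∀ {N} (P : Fin N → Bool) → count P ≡ 0 ⊎ Σ[ z ∈ Fin N ] T (P z)
count≡0⊎witness P with count P in eq
... | zero  = inj₁ refl
... | suc _ = inj₂ (count-witness (subst (1 ≤_) (sym eq) (s≤s z≤n)))

count-≥2 : ∀ {N} {P : Fin N → Bool} {a b : Fin N} → T (P a) → T (P b) → a ≢ b → 2 ≤ count P
count-≥2 {P = P} {zero}  {zero}  _  _  a≢b = contradiction refl a≢b
count-≥2 {P = P} {zero}  {suc b} Pa Pb _   with P zero
... | true = s≤s (count-pos {P = P ∘ suc} b Pb)
count-≥2 {P = P} {suc a} {zero}  Pa Pb _   with P zero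
... | true = s≤s (count-pos {P = P ∘ suc} a Pa)
count-≥2 {P = P} {suc a} {suc b} Pa Pb a≢b =
  ≤-trans (count-≥2 {P = P ∘ suc} Pa Pb (a≢b ∘ cong suc)) (m≤n+m _ (𝟙 (P zero)))

count-≤1 : ∀ {N} {P : Fin N → Bool} → (∀ w w' → T (P w) → T (P w') → w ≡ w') → count P ≤ 1
count-≤1 {zero}          _      = z≤n
count-≤1 {suc N} {P} unique with P zero in eq
... | true  = s≤s (≤-reflexive (count-none (λ w Pw → 0≢1+n (unique zero (suc w) (subst T (sym eq) tt) Pw))))
... | false = count-≤1 {P = P ∘ suc} (λ w w' Pw Pw' → suc-injective (unique (suc w) (suc w') Pw Pw'))

count≡1 : ∀ {N} {P : Fin N → Bool} (z : Fin N) → T (P z) → (∀ w → T (P w) → w ≡ z) → count P ≡ 1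
count≡1 z Pz only-z = ≤-antisym (count-≤1 (λ w w' Pw Pw' → trans (only-z w Pw) (sym (only-z w' Pw'))))
                                (count-pos z Pz)

count≡1⇒unique : ∀ {N} {P : Fin N → Bool} → count P ≡ 1 → ∀ {a b} → T (P a) → T (P b) → a ≡ b
count≡1⇒unique ΣP≡1 {a} {b} Pa Pb with a ≟ b
... | yes a≡b = a≡b
... | no  a≢b = contradiction (subst (2 ≤_) ΣP≡1 (count-≥2 Pa Pb a≢b)) 1+n≰n

count-< : ∀ {N} {P Q : Fin N → Bool} → (∀ z → T (P z) → T (Q z)) →
          (z : Fin N) → T (Q z) → ¬ T (P z) → count P < count Q
count-< {P = P} {Q} P⊆Q zero Qz ¬Pz with P zero | Q zero
... | false | true  = s≤s (count-mono {P = P ∘ suc} {Q = Q ∘ suc} (P⊆Q ∘ suc))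
... | true  | _     = ⊥-elim (¬Pz tt)
count-< {P = P} {Q} P⊆Q (suc z) Qz ¬Pz =
  +-mono-≤-< (𝟙-mono (P⊆Q zero))
             (count-< {P = P ∘ suc} {Q = Q ∘ suc} (P⊆Q ∘ suc) z Qz ¬Pz)

count-≥⇒⊇ : ∀ {N} {P Q : Fin N → Bool} → (∀ z → T (P z) → T (Q z)) → count Q ≤ count P →
            ∀ z → T (Q z) → T (P z)
count-≥⇒⊇ {P = P} P⊆Q ΣQ≤ΣP z Qz with P z in eq
... | true  = tt
... | false = contradiction ΣQ≤ΣP (<⇒≱ (count-< P⊆Q z Qz (subst T eq)))

count-other : ∀ {N} {P : Fin N → Bool} → 2 ≤ count P → ∀ {a} → T (P a) → Σ[ b ∈ Fin N ] T (P b) × b ≢ a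
count-other {suc N} {P} 2≤ΣP {zero} Pa with P zero
... | true = let b , Pb = count-witness {P = P ∘ suc} (≤-pred 2≤ΣP) in suc b , Pb , λ ()
count-other {suc N} {P} 2≤ΣP {suc a} Pa with P zero in eq
... | true  = zero , subst T (sym eq) tt , λ ()
... | false = let b , Pb , b≢a = count-other {P = P ∘ suc} 2≤ΣP Pa in suc b , Pb , b≢a ∘ suc-injective

count-filter : ∀ {N M} (P : Fin N → Bool) (c : Fin N → Fin M) (h : Fin M → Bool) →
  count (λ z → P z ∧ h (c z)) ≡ sum (λ t → if h t then count (λ z → P z ∧ (c z =ᶠ t)) else 0)
count-filter {N} {M} P c h = sym (begin
  sum (λ t → if h t then count (λ z → P z ∧ (c z =ᶠ t)) else 0)
    ≡⟨ sum-cong-≗ (λ t → if-sum (h t) (λ z → 𝟙 (P z ∧ (c z =ᶠ t)))) ⟩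
  sum (λ t → sum (λ z → if h t then 𝟙 (P z ∧ (c z =ᶠ t)) else 0))
    ≡⟨ sum-swap (λ t z → if h t then 𝟙 (P z ∧ (c z =ᶠ t)) else 0) ⟩
  sum (λ z → sum (λ t → if h t then 𝟙 (P z ∧ (c z =ᶠ t)) else 0))
    ≡⟨ sum-cong-≗ (λ z → sum-cong-≗ (λ t → if-𝟙-∧ (h t) (P z) (c z =ᶠ t))) ⟩
  sum (λ z → sum (λ t → if c z =ᶠ t then 𝟙 (P z ∧ h t) else 0))
    ≡⟨ sum-cong-≗ (λ z → sum-delta (c z) (λ t → 𝟙 (P z ∧ h t))) ⟩
  count (λ z → P z ∧ h (c z)) ∎)
  where
  open ≡-Reasoning
  if-sum : ∀ b (f : Fin N → ℕ) → (if b then sum f else 0) ≡ sum (λ z → if b then f z else 0)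
  if-sum true  f = refl
  if-sum false f = sym (sum-zero N)
  if-𝟙-∧ : ∀ a b e → (if a then 𝟙 (b ∧ e) else 0) ≡ (if e then 𝟙 (b ∧ a) else 0)
  if-𝟙-∧ true  b true  = refl
  if-𝟙-∧ true  b false = cong 𝟙 (∧-zeroʳ b)
  if-𝟙-∧ false b true  = cong 𝟙 (sym (∧-zeroʳ b))
  if-𝟙-∧ false b false = refl

count-partition : ∀ {N M} (P : Fin N → Bool) (c : Fin N → Fin M) →
                  sum (λ t → count (λ z → P z ∧ (c z =ᶠ t))) ≡ count P
count-partition P c = sym (trans (count-cong (λ z → sym (∧-identityʳ (P z))))
                                 (count-filter P c (λ _ → true)))

count-fibres≡1 : ∀ {N M} (c : Fin N → Fin M) (R : Fin N → Bool) → count R ≡ M →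
                 (∀ w w' → T (R w) → T (R w') → c w ≡ c w' → w ≡ w') →
                 ∀ t → count (λ w → R w ∧ (c w =ᶠ t)) ≡ 1
count-fibres≡1 c R ΣR≡M c-injective = sum≤1-≡M _ fibre≤1 (trans (count-partition R c) ΣR≡M)
  where
  fibre≤1 : ∀ t → count (λ w → R w ∧ (c w =ᶠ t)) ≤ 1
  fibre≤1 t = count-≤1 λ w w' h h' →
    let Rw , cw≡t = Equivalence.to T-∧ h ; Rw' , cw'≡t = Equivalence.to T-∧ h'
    in c-injective w w' Rw Rw' (trans (toWitness cw≡t) (sym (toWitness cw'≡t)))

subset-≡ : ∀ {N} {P : Fin N → Bool} {a b : Σ[ z ∈ Fin N ] T (P z)} → proj₁ a ≡ proj₁ b → a ≡ b
subset-≡ {a = z , h} {.z , h'} refl = cong (z ,_) (T-irrelevant h h')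

Fin-count↔ : ∀ {N} (P : Fin N → Bool) → Fin (count P) ↔ (Σ[ z ∈ Fin N ] T (P z))
Fin-count↔ {zero}  P = mk↔ₛ′ (λ ()) (λ ()) (λ ()) (λ ())
Fin-count↔ {suc N} P = Σ-Fin-suc↔ ↔-∘ ((Fin-𝟙↔T (P zero) ⊎-↔ Fin-count↔ (P ∘ suc)) ↔-∘ +↔⊎)
  where
  Fin-𝟙↔T : ∀ b → Fin (𝟙 b) ↔ T b
  Fin-𝟙↔T true  = 1↔⊤
  Fin-𝟙↔T false = 0↔⊥
  Σ-Fin-suc↔ : (T (P zero) ⊎ Σ[ z ∈ Fin N ] T (P (suc z))) ↔ (Σ[ z ∈ Fin (suc N) ] T (P z))
  Σ-Fin-suc↔ = mk↔ₛ′ to from to∘from from∘to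
    where
    to : T (P zero) ⊎ Σ[ z ∈ Fin N ] T (P (suc z)) → Σ[ z ∈ Fin (suc N) ] T (P z)
    to (inj₁ P0)        = zero , P0
    to (inj₂ (z , Psz)) = suc z , Psz
    from : Σ[ z ∈ Fin (suc N) ] T (P z) → T (P zero) ⊎ Σ[ z ∈ Fin N ] T (P (suc z))
    from (zero  , P0)  = inj₁ P0
    from (suc z , Psz) = inj₂ (z , Psz)
    to∘from : ∀ x → to (from x) ≡ x
    to∘from (zero  , _) = refl
    to∘from (suc _ , _) = refl
    from∘to : ∀ x → from (to x) ≡ x
    from∘to (inj₁ _) = refl
    from∘to (inj₂ _) = refl

count-≡ : ∀ {N m} {P : Fin N → Bool} → (Σ[ z ∈ Fin N ] T (P z)) ↔ Fin m → count P ≡ m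
count-≡ {N} {m} {P} Σ↔Fin = cantor-schröder-bernstein (Injection.injective (↔⇒↣ f)) (Injection.injective (↔⇒↣ (↔-sym f)))
  where
  f : Fin (count P) ↔ Fin m
  f = Σ↔Fin ↔-∘ Fin-count↔ P


-- Arithmetic of C_p ≀ C_p
subMod-+ : ∀ p (a b : Fin p) → subMod p a b + toℕ b ≡ (if toℕ b ≤ᵇ toℕ a then toℕ a else toℕ a + p)
subMod-+ p a b with toℕ b ≤ᵇ toℕ a in b≤ᵇa
... | true  = m∸n+n≡m (≤ᵇ⇒≤ (toℕ b) (toℕ a) (subst T (sym b≤ᵇa) tt))
... | false = m∸n+n≡m (≤-trans (<⇒≤ (toℕ<n b)) (m≤n+m p (toℕ a)))

subMod-injectiveˡ : ∀ p (b : Fin p) {a a' : Fin p} → subMod p a b ≡ subMod p a' b → a ≡ a'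
subMod-injectiveˡ p b {a} {a'} eq = toℕ-injective (unshift (toℕ<n a) (toℕ<n a') (begin
  (if toℕ b ≤ᵇ toℕ a then toℕ a else toℕ a + p)     ≡⟨ sym (subMod-+ p a b) ⟩
  subMod p a b + toℕ b                              ≡⟨ cong (_+ toℕ b) eq ⟩
  subMod p a' b + toℕ b                             ≡⟨ subMod-+ p a' b ⟩
  (if toℕ b ≤ᵇ toℕ a' then toℕ a' else toℕ a' + p)  ∎))
  where
  open ≡-Reasoning
  unshift : ∀ {m n c c'} → m < p → n < p →
            (if c then m else m + p) ≡ (if c' then n else n + p) → m ≡ n
  unshift {c = true}  {true}  _   _   m≡n   = m≡n
  unshift {c = false} {false} _   _   eq    = +-cancelʳ-≡ p _ _ eq
  unshift {c = true}  {false} m<p _   m≡n+p = contradiction (subst (_< p) m≡n+p m<p) (m+n≮n _ p)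
  unshift {c = false} {true}  _   n<p m+p≡n = contradiction (subst (_< p) (sym m+p≡n) n<p) (m+n≮n _ p)

another : ∀ {p} → 2 ≤ p → (a : Fin p) → Σ[ b ∈ Fin p ] b ≢ a
another (s≤s (s≤s _)) a = punchIn a zero , punchInᵢ≢i a zero

wreathCol-sameRow : ∀ p (c c' : Fin p × Fin p) → proj₂ c ≡ proj₂ c' →
                    wreathCol p c c' ≡ inj₁ (subMod p (proj₁ c') (proj₁ c))
wreathCol-sameRow p (_ , y₁) (_ , y₂) y₁≡y₂ rewrite ≡⇒=ᶠ y₁≡y₂ = refl

wreathCol-otherRow : ∀ p (c c' : Fin p × Fin p) → proj₂ c ≢ proj₂ c' →
                     wreathCol p c c' ≡ inj₂ (subMod p (proj₂ c') (proj₂ c))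
wreathCol-otherRow p (_ , y₁) (_ , y₂) y₁≢y₂ rewrite ≢⇒=ᶠ y₁≢y₂ = refl

module Configuration {N r : ℕ} (X : CoherentConfiguration N r) where
  open CC X

  fiberSize : Fin r → ℕ
  fiberSize d = count (λ z → col z z =ᶠ d)

  -- pathCount s t x y is the structure constant c_{st}^u of u = col x y.
  pathCount : Fin r → Fin r → Fin N → Fin N → ℕ
  pathCount s t x y = count (λ z → (col x z =ᶠ s) ∧ (col z y =ᶠ t))

  pathCount-constant : ∀ s t {x y x' y'} → col x y ≡ col x' y' → pathCount s t x y ≡ pathCount s t x' y'
  pathCount-constant s t {x} {y} {x'} {y'} xy~x'y' =
    trans (sym (countF≡count (λ z → (col x z =ᶠ s) ∧ (col z y =ᶠ t))))
          (trans (constants s t x y x' y' xy~x'y') (countF≡count (λ z → (col x' z =ᶠ s) ∧ (col z y' =ᶠ t))))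

  path-transfer : ∀ {s t x y x' y' z} → col x y ≡ col x' y' → col x z ≡ s → col z y ≡ t →
                  Σ[ z' ∈ Fin N ] col x' z' ≡ s × col z' y' ≡ t
  path-transfer {s} {t} {x} {y} {x'} {y'} {z} xy~x'y' xz zy =
    let z' , h = count-witness {P = λ z → (col x' z =ᶠ s) ∧ (col z y' =ᶠ t)} (subst (1 ≤_) (pathCount-constant s t xy~x'y')
                                      (count-pos z (Equivalence.from T-=ᶠ∧=ᶠ (xz , zy))))
    in z' , Equivalence.to T-=ᶠ∧=ᶠ h

  pathCount-filter : ∀ s (h : Fin r → Bool) {x y x' y'} → col x y ≡ col x' y' →
    count (λ z → (col x z =ᶠ s) ∧ h (col z y)) ≡ count (λ z → (col x' z =ᶠ s) ∧ h (col z y'))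
  pathCount-filter s h {x} {y} {x'} {y'} xy~x'y' = begin
    count (λ z → (col x z =ᶠ s) ∧ h (col z y))
      ≡⟨ count-filter _ (λ z → col z y) h ⟩
    sum (λ t → if h t then pathCount s t x y else 0)
      ≡⟨ sum-cong-≗ (λ t → cong (λ n → if h t then n else 0) (pathCount-constant s t xy~x'y')) ⟩
    sum (λ t → if h t then pathCount s t x' y' else 0)
      ≡⟨ count-filter _ (λ z → col z y') h ⟨
    count (λ z → (col x' z =ᶠ s) ∧ h (col z y')) ∎
    where open ≡-Reasoning

  *-intro : ∀ {s x y} → col x y ≡ s → col y x ≡ s *
  *-intro {s} {x} {y} xy≡s = transp x y _ _ (trans xy≡s (sym (proj₂ (proj₂ (nonempty s)))))

  *-elim : ∀ {s x y} → col y x ≡ s * → col x y ≡ s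
  *-elim {s} {x} {y} yx≡s* = trans (transp y x _ _ yx≡s*) (proj₂ (proj₂ (nonempty s)))

  =ᶠ-* : ∀ s x y → (col x y =ᶠ s) ≡ (col y x =ᶠ (s *))
  =ᶠ-* s x y = T-⇔⇒≡ (mk⇔ (fromWitness ∘ *-intro ∘ toWitness) (fromWitness ∘ *-elim ∘ toWitness))

  fiberˡ : ∀ {x y x' y'} → col x y ≡ col x' y' → col x x ≡ col x' x'
  fiberˡ {x} {y} xy~x'y' with path-transfer {z = x} xy~x'y' refl refl
  ... | z' , x'z'≡xx , _ with diagUnion x _ z' (sym x'z'≡xx)
  ... | refl = sym x'z'≡xx

  fiberʳ : ∀ {x y x' y'} → col x y ≡ col x' y' → col y y ≡ col y' y'
  fiberʳ {x} {y} {x'} {y'} xy~x'y' = fiberˡ (transp x y x' y' xy~x'y')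

  valency-fiber : ∀ u {α α'} → col α α ≡ col α' α' → count (λ β → col α β =ᶠ u) ≡ count (λ β → col α' β =ᶠ u)
  valency-fiber u {α} {α'} αα~α'α' = begin
    count (λ β → col α β =ᶠ u)   ≡⟨ count-cong (back-and-forth α) ⟩
    pathCount u (u *) α α        ≡⟨ pathCount-constant u (u *) αα~α'α' ⟩
    pathCount u (u *) α' α'      ≡⟨ count-cong (back-and-forth α') ⟨
    count (λ β → col α' β =ᶠ u)  ∎
    where
    open ≡-Reasoning
    back-and-forth : ∀ a β → (col a β =ᶠ u) ≡ ((col a β =ᶠ u) ∧ (col β a =ᶠ (u *)))
    back-and-forth a β rewrite =ᶠ-* u a β = sym (∧-idem _)

  pathCount-diagonal : ∀ t x → pathCount t (t *) x x ≡ count (λ z → col x z =ᶠ t)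
  pathCount-diagonal t x = count-cong λ z → trans (cong ((col x z =ᶠ t) ∧_) (sym (=ᶠ-* t x z))) (∧-idem _)

  pathCount-diagonal* : ∀ t x → pathCount (t *) t x x ≡ count (λ z → col x z =ᶠ (t *))
  pathCount-diagonal* t x = count-cong λ z → trans (cong ((col x z =ᶠ (t *)) ∧_) (=ᶠ-* t z x)) (∧-idem _)

  product-pathCount : ∀ a b x y → (σ a · σ b) x y ≡ pathCount a b x y
  product-pathCount a b x y = trans (sumF≡sum (λ z → σ a x z * σ b z y)) (sum-cong-≗ (λ z → 𝟙-∧ (col x z =ᶠ a) (col z y =ᶠ b)))
    where
    𝟙-∧ : ∀ b c → 𝟙 b * 𝟙 c ≡ 𝟙 (b ∧ c)
    𝟙-∧ true  true  = refl
    𝟙-∧ true  false = refl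
    𝟙-∧ false _     = refl

  σNonThin-col : ∀ d x y → σNonThin d x y ≡ 𝟙 (inSᵇ (col x y) d d ∧ not (thinᵇ (col x y) d))
  σNonThin-col d x y = begin
    σNonThin d x y
      ≡⟨ sumF≡sum (λ u → if inSᵇ u d d ∧ not (thinᵇ u d) then σ u x y else 0) ⟩
    sum (λ u → if inSᵇ u d d ∧ not (thinᵇ u d) then σ u x y else 0)
      ≡⟨ sum-cong-≗ (λ u → if-𝟙-comm (inSᵇ u d d ∧ not (thinᵇ u d)) (col x y =ᶠ u)) ⟩
    sum (λ u → if col x y =ᶠ u then 𝟙 (inSᵇ u d d ∧ not (thinᵇ u d)) else 0)
      ≡⟨ sum-delta (col x y) (λ u → 𝟙 (inSᵇ u d d ∧ not (thinᵇ u d))) ⟩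
    𝟙 (inSᵇ (col x y) d d ∧ not (thinᵇ (col x y) d)) ∎
    where
    open ≡-Reasoning
    if-𝟙-comm : ∀ b c → (if b then 𝟙 c else 0) ≡ (if c then 𝟙 b else 0)
    if-𝟙-comm true  true  = refl
    if-𝟙-comm true  false = refl
    if-𝟙-comm false true  = refl
    if-𝟙-comm false false = refl

  T-inSᵇ : ∀ {u d} → T (inSᵇ u d d) ⇔ (∀ x y → col x y ≡ u → col x x ≡ d × col y y ≡ d)
  T-inSᵇ = mk⇔
    (λ h x y xy≡u → Equivalence.to T-=ᶠ∧=ᶠ (Equivalence.to T-not∨
       (Equivalence.to (T-all-allFin _) (Equivalence.to (T-all-allFin _) h x) y) (fromWitness xy≡u)))
    (λ h → Equivalence.from (T-all-allFin _) λ x → Equivalence.from (T-all-allFin _) λ y →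
       Equivalence.from T-not∨ (Equivalence.from T-=ᶠ∧=ᶠ ∘ h x y ∘ toWitness))

  T-inSᵇ-col : ∀ {d x y} → T (inSᵇ (col x y) d d) ⇔ (col x x ≡ d × col y y ≡ d)
  T-inSᵇ-col {d} {x} {y} = mk⇔ (λ h → Equivalence.to T-inSᵇ h x y refl)
    (λ (xx≡d , yy≡d) → Equivalence.from (T-inSᵇ {col x y} {d}) λ x' y' x'y'≡xy →
       trans (fiberˡ x'y'≡xy) xx≡d , trans (fiberʳ x'y'≡xy) yy≡d)

  T-thinᵇ : ∀ {u d α} → col α α ≡ d → T (thinᵇ u d) ⇔ (count (λ β → col α β =ᶠ u) ≡ 1)
  T-thinᵇ {u} {d} {α} αα≡d = mk⇔
    (λ h → trans (sym (countF≡count (valency α))) (≡ᵇ⇒≡ _ 1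
       (Equivalence.to (T-not∨ {col α α =ᶠ d}) (Equivalence.to (T-all-allFin entry) h α) (fromWitness αα≡d))))
    (λ valency≡1 → Equivalence.from (T-all-allFin entry) λ α' → Equivalence.from (T-not∨ {col α' α' =ᶠ d}) λ α'α'≡d →
       ≡⇒≡ᵇ _ 1 (trans (countF≡count (valency α'))
         (trans (valency-fiber u (trans (toWitness α'α'≡d) (sym αα≡d))) valency≡1)))
    where
    valency : Fin N → Fin N → Bool
    valency α' β = col α' β =ᶠ u
    entry : Fin N → Bool
    entry α' = not (col α' α' =ᶠ d) ∨ (countF (valency α') ≡ᵇ 1)

  valency-* : ∀ {s i j n} → InS s i j → ValencyIs s i n → ∀ {a} → col a a ≡ j →
              count (λ β → col a β =ᶠ (s *)) * fiberSize j ≡ n * fiberSize i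
  valency-* {s} {i} {j} {n} s∈Sij valency {a} aa≡j = begin
    count (λ β → col a β =ᶠ (s *)) * fiberSize j
      ≡⟨ sum-on (λ w → col w w =ᶠ j) (λ w ww≡j → in-degree (toWitness ww≡j)) (λ w ww≢j → count-none λ z zw≡s →
           ww≢j (fromWitness (proj₂ (s∈Sij z w (toWitness zw≡s))))) ⟨
    sum (λ w → count (λ z → col z w =ᶠ s))
      ≡⟨ sum-swap (λ w z → 𝟙 (col z w =ᶠ s)) ⟩
    sum (λ z → count (λ w → col z w =ᶠ s))
      ≡⟨ sum-on (λ z → col z z =ᶠ i) (λ z zz≡i → out-degree (toWitness zz≡i)) (λ z zz≢i → count-none λ w zw≡s →
           zz≢i (fromWitness (proj₁ (s∈Sij z w (toWitness zw≡s))))) ⟩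
    n * fiberSize i ∎
    where
    open ≡-Reasoning
    out-degree : ∀ {z} → col z z ≡ i → count (λ w → col z w =ᶠ s) ≡ n
    out-degree {z} zz≡i = trans (sym (countF≡count (λ w → col z w =ᶠ s))) (valency z zz≡i)
    in-degree : ∀ {w} → col w w ≡ j → count (λ z → col z w =ᶠ s) ≡ count (λ β → col a β =ᶠ (s *))
    in-degree {w} ww≡j = trans (count-cong (λ z → =ᶠ-* s z w)) (valency-fiber (s *) (trans ww≡j (sym aa≡j)))

module WreathFiber {N r : ℕ} (X : CoherentConfiguration N r) {p : ℕ} (2≤p : 2 ≤ p)
                   {d : Fin r} (d-fiber : CC.IsFiber X d) (iso : IsoWreath X p d) where
  open CC X
  open Configuration X

  coord : Fiber X d ↔ (Fin p × Fin p)
  coord = ⤖⇒↔ (proj₁ iso)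

  coords : (z : Fin N) → col z z ≡ d → Fin p × Fin p
  coords z zz≡d = Inverse.to coord (z , zz≡d)

  coords-irrelevant : ∀ {z} (e e' : col z z ≡ d) → coords z e ≡ coords z e'
  coords-irrelevant e e' = cong (coords _) (Decidable⇒UIP.≡-irrelevant _≟_ e e')

  coords-≡ : ∀ {z z'} → z ≡ z' → (e : col z z ≡ d) (e' : col z' z' ≡ d) → coords z e ≡ coords z' e'
  coords-≡ refl = coords-irrelevant

  coords-injective : ∀ {z z'} (e : col z z ≡ d) (e' : col z' z' ≡ d) → coords z e ≡ coords z' e' → z ≡ z'
  coords-injective e e' eq = cong proj₁ (Injection.injective (↔⇒↣ coord) eq)

  coords-surjective : (c : Fin p × Fin p) → Σ[ z ∈ Fin N ] Σ[ e ∈ col z z ≡ d ] coords z e ≡ c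
  coords-surjective c = let z , e = Inverse.from coord c in z , e , Inverse.strictlyInverseˡ coord c

  col≡⇔wreathCol≡ : ∀ {u v u' v'} (eu : col u u ≡ d) (ev : col v v ≡ d) (eu' : col u' u' ≡ d) (ev' : col v' v' ≡ d) →
    col u v ≡ col u' v' ⇔ wreathCol p (coords u eu) (coords v ev) ≡ wreathCol p (coords u' eu') (coords v' ev')
  col≡⇔wreathCol≡ eu ev eu' ev' = proj₂ iso (_ , eu) (_ , ev) (_ , eu') (_ , ev')

  row : (z : Fin N) → col z z ≡ d → Fin p
  row z zz≡d = proj₂ (coords z zz≡d)

  -- Off the fiber Ω_d the value of block is junk.
  block : Fin N → Fin p
  block z with col z z ≟ d
  ... | yes zz≡d = row z zz≡d
  ... | no  _    = row (proj₁ d-fiber) (proj₂ d-fiber)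

  block-row : ∀ {z} (zz≡d : col z z ≡ d) → block z ≡ row z zz≡d
  block-row {z} zz≡d with col z z ≟ d
  ... | yes e    = cong proj₂ (coords-irrelevant e zz≡d)
  ... | no  zz≢d = contradiction zz≡d zz≢d

  col-otherBlock : ∀ {u v v'} (eu : col u u ≡ d) (ev : col v v ≡ d) (ev' : col v' v' ≡ d) →
                   block v ≡ block v' → block u ≢ block v → col u v ≡ col u v'
  col-otherBlock {u} {v} {v'} eu ev ev' bv≡bv' bu≢bv =
    Equivalence.from (col≡⇔wreathCol≡ eu ev eu ev') (begin
      wreathCol p (coords u eu) (coords v ev)   ≡⟨ wreathCol-otherRow p (coords u eu) (coords v ev) ru≢rv ⟩
      inj₂ (subMod p (row v ev) (row u eu))     ≡⟨ cong (λ c → inj₂ (subMod p c (row u eu))) rv≡rv' ⟩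
      inj₂ (subMod p (row v' ev') (row u eu))   ≡⟨ wreathCol-otherRow p (coords u eu) (coords v' ev') (ru≢rv ∘ flip trans (sym rv≡rv')) ⟨
      wreathCol p (coords u eu) (coords v' ev') ∎)
    where
    open ≡-Reasoning
    rv≡rv' : row v ev ≡ row v' ev'
    rv≡rv' = trans (sym (block-row ev)) (trans bv≡bv' (block-row ev'))
    ru≢rv : row u eu ≢ row v ev
    ru≢rv ru≡rv = bu≢bv (trans (block-row eu) (trans ru≡rv (sym (block-row ev))))

  col-sameBlock-injective : ∀ {u v v'} (eu : col u u ≡ d) (ev : col v v ≡ d) (ev' : col v' v' ≡ d) →
                            block u ≡ block v → col u v ≡ col u v' → v ≡ v'
  col-sameBlock-injective {u} {v} {v'} eu ev ev' bu≡bv uv~uv' =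
    coords-injective ev ev' (×-≡,≡→≡ (column-equal , trans (sym ru≡rv) ru≡rv'))
    where
    open ≡-Reasoning
    ru≡rv : row u eu ≡ row v ev
    ru≡rv = trans (sym (block-row eu)) (trans bu≡bv (block-row ev))
    same-wreathCol : wreathCol p (coords u eu) (coords v ev) ≡ wreathCol p (coords u eu) (coords v' ev')
    same-wreathCol = Equivalence.to (col≡⇔wreathCol≡ eu ev eu ev') uv~uv'
    ru≡rv' : row u eu ≡ row v' ev'
    ru≡rv' = decidable-stable (row u eu ≟ row v' ev') λ ru≢rv' → case
      trans (sym (wreathCol-sameRow p (coords u eu) (coords v ev) ru≡rv))
            (trans same-wreathCol (wreathCol-otherRow p (coords u eu) (coords v' ev') ru≢rv')) of λ ()
    column-equal : proj₁ (coords v ev) ≡ proj₁ (coords v' ev')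
    column-equal = subMod-injectiveˡ p (proj₁ (coords u eu)) (inj₁-injective (begin
      inj₁ (subMod p (proj₁ (coords v ev)) (proj₁ (coords u eu)))   ≡⟨ wreathCol-sameRow p (coords u eu) (coords v ev) ru≡rv ⟨
      wreathCol p (coords u eu) (coords v ev)                       ≡⟨ same-wreathCol ⟩
      wreathCol p (coords u eu) (coords v' ev')                     ≡⟨ wreathCol-sameRow p (coords u eu) (coords v' ev') ru≡rv' ⟩
      inj₁ (subMod p (proj₁ (coords v' ev')) (proj₁ (coords u eu))) ∎))

  block-other : ∀ {v} → col v v ≡ d → Σ[ v' ∈ Fin N ] col v' v' ≡ d × block v' ≡ block v × v' ≢ v
  block-other {v} ev =
    let a' , a'≢a = another 2≤p (proj₁ (coords v ev)) ; v' , ev' , cv'≡ = coords-surjective (a' , row v ev)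
    in v' , ev' , trans (block-row ev') (trans (cong proj₂ cv'≡) (sym (block-row ev))) ,
       λ v'≡v → a'≢a (trans (cong proj₁ (sym cv'≡)) (cong proj₁ (coords-≡ v'≡v ev' ev)))

  InBlock : Fin p → Fin N → Bool
  InBlock b z = (col z z =ᶠ d) ∧ (block z =ᶠ b)

  blockSize : ∀ b → count (InBlock b) ≡ p
  blockSize b = count-≡ (mk↔ₛ′ to from to∘from from∘to)
    where
    to : Σ[ z ∈ Fin N ] T (InBlock b z) → Fin p
    to (z , h) = proj₁ (coords z (proj₁ (Equivalence.to T-=ᶠ∧=ᶠ h)))
    from : Fin p → Σ[ z ∈ Fin N ] T (InBlock b z)
    from a = let z , e , cz≡ab = coords-surjective (a , b)
             in z , Equivalence.from T-=ᶠ∧=ᶠ (e , trans (block-row e) (cong proj₂ cz≡ab))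
    to∘from : ∀ a → to (from a) ≡ a
    to∘from a = let z , e , cz≡ab = coords-surjective (a , b)
                in cong proj₁ (trans (coords-irrelevant _ e) cz≡ab)
    from∘to : ∀ x → from (to x) ≡ x
    from∘to (z , h) = let zz≡d , bz≡b = Equivalence.to T-=ᶠ∧=ᶠ h
                          z' , e' , cz'≡ = coords-surjective (proj₁ (coords z zz≡d) , b)
      in subset-≡ (coords-injective e' zz≡d
           (trans cz'≡ (×-≡,≡→≡ (refl , trans (sym bz≡b) (block-row zz≡d)))))

  fiberSize≡p*p : fiberSize d ≡ p * p
  fiberSize≡p*p = begin
    count (λ z → col z z =ᶠ d)    ≡⟨ count-partition (λ z → col z z =ᶠ d) block ⟨
    sum (λ b → count (InBlock b)) ≡⟨ sum-cong-≗ blockSize ⟩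
    sum {p} (λ _ → p)             ≡⟨ sum-if {p} (λ _ → true) p ⟩
    p * sum {p} (λ _ → 1)         ≡⟨ cong (p *_) (sum-one p) ⟩
    p * p                         ∎
    where open ≡-Reasoning

  thinᵇ-col : ∀ {u v} → col u u ≡ d → col v v ≡ d → thinᵇ (col u v) d ≡ (block u =ᶠ block v)
  thinᵇ-col {u} {v} eu ev = T-⇔⇒≡ (mk⇔ (fromWitness ∘ thin⇒sameBlock) (sameBlock⇒thin ∘ toWitness))
    where
    thin⇒sameBlock : T (thinᵇ (col u v) d) → block u ≡ block v
    thin⇒sameBlock thin = decidable-stable (block u ≟ block v) λ bu≢bv →
      let v' , ev' , bv'≡bv , v'≢v = block-other ev
          uv'~uv = col-otherBlock eu ev' ev bv'≡bv (bu≢bv ∘ flip trans bv'≡bv)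
      in contradiction (subst (2 ≤_) (Equivalence.to (T-thinᵇ eu) thin)
           (count-≥2 {P = λ β → col u β =ᶠ col u v} (fromWitness uv'~uv) (fromWitness refl) v'≢v)) 1+n≰n
    sameBlock⇒thin : block u ≡ block v → T (thinᵇ (col u v) d)
    sameBlock⇒thin bu≡bv = Equivalence.from (T-thinᵇ eu) (count≡1 v (fromWitness refl) λ w uw≡uv →
      let ew = trans (fiberʳ (toWitness uw≡uv)) ev
      in sym (col-sameBlock-injective eu ev ew bu≡bv (sym (toWitness uw≡uv))))

  block-double-count : (L : Fin N → Bool) (R : Fin N → Fin N → Bool) {y : Fin N} →
    (∀ {y'} → col y' y' ≡ d → block y' ≡ block y → count (λ z → L z ∧ R z y') ≡ count (λ z → L z ∧ R z y)) →
    count (λ z → L z ∧ R z y) * p ≡ sum (λ z → if L z then count (λ y' → InBlock (block y) y' ∧ R z y') else 0)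
  block-double-count L R {y} constant = begin
    c * p
      ≡⟨ cong (c *_) (blockSize (block y)) ⟨
    c * count B
      ≡⟨ sum-on B on off ⟨
    sum (λ y' → count (λ z → B y' ∧ (L z ∧ R z y')))
      ≡⟨ sum-swap (λ y' z → 𝟙 (B y' ∧ (L z ∧ R z y'))) ⟩
    sum (λ z → count (λ y' → B y' ∧ (L z ∧ R z y')))
      ≡⟨ sum-cong-≗ (λ z → trans (count-cong (λ y' → ∧-exchange (B y') (L z) (R z y'))) (count-∧-const (L z) (λ y' → B y' ∧ R z y'))) ⟩
    sum (λ z → if L z then count (λ y' → B y' ∧ R z y') else 0) ∎
    where
    open ≡-Reasoning
    c : ℕ
    c = count (λ z → L z ∧ R z y)
    B : Fin N → Bool
    B = InBlock (block y)
    on : ∀ y' → T (B y') → count (λ z → B y' ∧ (L z ∧ R z y')) ≡ c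
    on y' h = let ey' , by'≡by = Equivalence.to T-=ᶠ∧=ᶠ h
              in trans (count-∧-true {P = λ z → L z ∧ R z y'} h) (constant ey' by'≡by)
    off : ∀ y' → ¬ T (B y') → count (λ z → B y' ∧ (L z ∧ R z y')) ≡ 0
    off y' ¬h = count-none {P = λ z → B y' ∧ (L z ∧ R z y')} (λ z h → ¬h (proj₁ (Equivalence.to (T-∧ {B y'}) h)))

  transversal : (R : Fin N → Bool) → count R ≡ p → (∀ y → T (R y) → col y y ≡ d) →
                (∀ y y' → T (R y) → T (R y') → block y ≡ block y' → y ≡ y') →
                ∀ b → count (λ y → InBlock b y ∧ R y) ≡ 1
  transversal R ΣR≡p R⊆Ωd R-distinctBlocks b = trans (count-cong reorder) (count-fibres≡1 block R ΣR≡p R-distinctBlocks b)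
    where
    reorder : ∀ y → (InBlock b y ∧ R y) ≡ (R y ∧ (block y =ᶠ b))
    reorder y = T-⇔⇒≡ (mk⇔
      (λ h → let inBlock , Ry = Equivalence.to (T-∧ {InBlock b y}) h
             in Equivalence.from T-∧ (Ry , proj₂ (Equivalence.to (T-∧ {col y y =ᶠ d}) inBlock)))
      (λ h → let Ry , by≡b = Equivalence.to (T-∧ {R y}) h
             in Equivalence.from T-∧ (Equivalence.from T-∧ (fromWitness (R⊆Ωd y Ry) , by≡b) , Ry)))

  count≡1-by-blocks : (L : Fin N → Bool) (R : Fin N → Fin N → Bool) {y : Fin N} →
    (∀ {y'} → col y' y' ≡ d → block y' ≡ block y → count (λ z → L z ∧ R z y') ≡ count (λ z → L z ∧ R z y)) →
    (∀ z → T (L z) → count (λ y' → InBlock (block y) y' ∧ R z y') ≡ 1) →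
    count L ≡ p → count (λ z → L z ∧ R z y) ≡ 1
  count≡1-by-blocks L R {y} constant one-per-block ΣL≡p = *-cancelʳ-≡ _ 1 p {{p≢0}} (begin
    count (λ z → L z ∧ R z y) * p
      ≡⟨ block-double-count L R constant ⟩
    sum (λ z → if L z then count (λ y' → InBlock (block y) y' ∧ R z y') else 0)
      ≡⟨ sum-on L (λ z Lz → trans (if-T Lz) (one-per-block z Lz)) (λ z ¬Lz → if-¬T ¬Lz) ⟩
    1 * count L
      ≡⟨ cong (1 *_) ΣL≡p ⟩
    1 * p ∎)
    where
    open ≡-Reasoning
    p≢0 : NonZero p
    p≢0 = >-nonZero (≤-trans (s≤s z≤n) 2≤p)

  on-diagonal : ∀ {x y} → col x y ≡ d → x ≡ y × col x x ≡ d
  on-diagonal {x} {y} xy≡d with diagUnion (proj₁ d-fiber) x y (trans (proj₂ d-fiber) (sym xy≡d))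
  ... | refl = refl , xy≡d

  nonThin-col : ∀ {x y} → col x x ≡ d → col y y ≡ d →
                (inSᵇ (col x y) d d ∧ not (thinᵇ (col x y) d)) ≡ not (block x =ᶠ block y)
  nonThin-col xx≡d yy≡d = cong₂ (λ a b → a ∧ not b)
    (Equivalence.to T-≡ (Equivalence.from T-inSᵇ-col (xx≡d , yy≡d))) (thinᵇ-col xx≡d yy≡d)

  σ-decomposition : ∀ {x y a b} → (col x y =ᶠ d) ≡ a → (inSᵇ (col x y) d d ∧ not (thinᵇ (col x y) d)) ≡ b →
                    p * σ d x y + σNonThin d x y ≡ p * 𝟙 a + 𝟙 b
  σ-decomposition {x} {y} σ≡ nonThin≡ =
    cong₂ (λ a b → p * 𝟙 a + b) σ≡ (trans (σNonThin-col d x y) (cong 𝟙 nonThin≡))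

  product-formula : (F : Fin N → Fin N → ℕ) →
    (∀ {x y} → ¬ (col x x ≡ d × col y y ≡ d) → F x y ≡ 0) →
    (∀ {x} → col x x ≡ d → F x x ≡ p) →
    (∀ {x y} → col x x ≡ d → col y y ≡ d → x ≢ y → block x ≡ block y → F x y ≡ 0) →
    (∀ {x y} → col x x ≡ d → col y y ≡ d → block x ≢ block y → F x y ≡ 1) →
    ∀ x y → F x y ≡ p * σ d x y + σNonThin d x y
  product-formula F outside diagonal sameBlock otherBlock x y = cases (col x x ≟ d ×-dec col y y ≟ d)
    where
    open ≡-Reasoning
    nonThin≡ : col x x ≡ d → col y y ≡ d → ∀ {b} → (block x =ᶠ block y) ≡ b →
               (inSᵇ (col x y) d d ∧ not (thinᵇ (col x y) d)) ≡ not b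
    nonThin≡ xx≡d yy≡d sameBlock≡b = trans (nonThin-col xx≡d yy≡d) (cong not sameBlock≡b)
    p*0+0≡0 : p * 0 + 0 ≡ 0
    p*0+0≡0 = trans (+-identityʳ (p * 0)) (*-zeroʳ p)
    xy≢d : x ≢ y → col x y ≢ d
    xy≢d x≢y = x≢y ∘ proj₁ ∘ on-diagonal
    cases : Dec (col x x ≡ d × col y y ≡ d) → F x y ≡ p * σ d x y + σNonThin d x y
    cases (no ¬in) = begin
      F x y                         ≡⟨ outside ¬in ⟩
      0                             ≡⟨ p*0+0≡0 ⟨
      p * 0 + 0                     ≡⟨ σ-decomposition (≢⇒=ᶠ xy≢d') (cong (_∧ not (thinᵇ (col x y) d)) (¬T⇒≡false (¬in ∘ Equivalence.to T-inSᵇ-col))) ⟨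
      p * σ d x y + σNonThin d x y  ∎
      where
      xy≢d' : col x y ≢ d
      xy≢d' xy≡d = let x≡y , xx≡d = on-diagonal xy≡d in ¬in (xx≡d , subst (λ w → col w w ≡ d) x≡y xx≡d)
    cases (yes (xx≡d , yy≡d)) with x ≟ y | block x ≟ block y
    ... | yes x≡y | _ = begin
      F x y                         ≡⟨ subst (λ w → F x w ≡ p) x≡y (diagonal xx≡d) ⟩
      p                             ≡⟨ trans (+-identityʳ (p * 1)) (*-identityʳ p) ⟨
      p * 1 + 0                     ≡⟨ σ-decomposition (≡⇒=ᶠ (subst (λ w → col x w ≡ d) x≡y xx≡d))
                                                       (nonThin≡ xx≡d yy≡d (≡⇒=ᶠ (cong block x≡y))) ⟨
      p * σ d x y + σNonThin d x y  ∎
    ... | no x≢y | yes bx≡by = begin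
      F x y                         ≡⟨ sameBlock xx≡d yy≡d x≢y bx≡by ⟩
      0                             ≡⟨ p*0+0≡0 ⟨
      p * 0 + 0                     ≡⟨ σ-decomposition (≢⇒=ᶠ (xy≢d x≢y)) (nonThin≡ xx≡d yy≡d (≡⇒=ᶠ bx≡by)) ⟨
      p * σ d x y + σNonThin d x y  ∎
    ... | no x≢y | no bx≢by = begin
      F x y                         ≡⟨ otherBlock xx≡d yy≡d bx≢by ⟩
      1                             ≡⟨ trans (+-comm (p * 0) 1) (cong suc (*-zeroʳ p)) ⟨
      p * 0 + 1                     ≡⟨ σ-decomposition (≢⇒=ᶠ (xy≢d x≢y)) (nonThin≡ xx≡d yy≡d (≢⇒=ᶠ bx≢by)) ⟨
      p * σ d x y + σNonThin d x y  ∎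

module NonRegular (p : ℕ) (p-prime : Prime p) {N r : ℕ} (X : CoherentConfiguration N r)
  (wreath : ∀ d → CC.IsFiber X d → IsoWreath X p d)
  {i j s : Fin r} (i-fiber : CC.IsFiber X i) (j-fiber : CC.IsFiber X j) (s∈Sij : CC.InS X s i j)
  (s-nonregular : ¬ CC.Regular X s) (s-valency : CC.ValencyIs X s i p) where
  open CC X
  open Configuration X

  instance
    p-nonTrivial : NonTrivial p
    p-nonTrivial = prime⇒nonTrivial p-prime
    p-nonZero : NonZero p
    p-nonZero = nonTrivial⇒nonZero p

  2≤p : 2 ≤ p
  2≤p = nonTrivial⇒n>1 p

  module Ωi = WreathFiber X 2≤p i-fiber (wreath i i-fiber)
  module Ωj = WreathFiber X 2≤p j-fiber (wreath j j-fiber)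

  s-source : ∀ {x z} → col x z ≡ s → col x x ≡ i
  s-source {x} {z} xz≡s = proj₁ (s∈Sij x z xz≡s)

  s-target : ∀ {x z} → col x z ≡ s → col z z ≡ j
  s-target {x} {z} xz≡s = proj₂ (s∈Sij x z xz≡s)

  out-degree : ∀ {x} → col x x ≡ i → count (λ z → col x z =ᶠ s) ≡ p
  out-degree {x} xx≡i = trans (sym (countF≡count (λ z → col x z =ᶠ s))) (s-valency x xx≡i)

  in-degree : ∀ {a} → col a a ≡ j → count (λ z → col a z =ᶠ (s *)) ≡ p
  in-degree {a} aa≡j = *-cancelʳ-≡ _ p (p * p) {{m*n≢0 p p}} (begin
    count (λ z → col a z =ᶠ (s *)) * (p * p)  ≡⟨ cong (count (λ z → col a z =ᶠ (s *)) *_) Ωj.fiberSize≡p*p ⟨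
    count (λ z → col a z =ᶠ (s *)) * fiberSize j ≡⟨ valency-* s∈Sij s-valency aa≡j ⟩
    p * fiberSize i                           ≡⟨ cong (p *_) Ωi.fiberSize≡p*p ⟩
    p * (p * p)                               ∎)
    where open ≡-Reasoning

  blockDegree : Fin N → Fin N → ℕ
  blockDegree x a = count (λ z → (col x z =ᶠ s) ∧ (Ωj.block z =ᶠ Ωj.block a))

  blockDegree-constant : ∀ {x a x' a'} → col x a ≡ s → col x' a' ≡ s → blockDegree x a ≡ blockDegree x' a'
  blockDegree-constant {x} {a} {x'} {a'} xa≡s x'a'≡s = begin
    blockDegree x a                                       ≡⟨ via-thin xa≡s ⟩
    count (λ z → (col x z =ᶠ s) ∧ thinᵇ (col z a) j)      ≡⟨ pathCount-filter s (λ t → thinᵇ t j) (trans xa≡s (sym x'a'≡s)) ⟩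
    count (λ z → (col x' z =ᶠ s) ∧ thinᵇ (col z a') j)    ≡⟨ via-thin x'a'≡s ⟨
    blockDegree x' a'                                     ∎
    where
    open ≡-Reasoning
    via-thin : ∀ {x a} → col x a ≡ s → blockDegree x a ≡ count (λ z → (col x z =ᶠ s) ∧ thinᵇ (col z a) j)
    via-thin {x} xa≡s = count-cong λ z → ∧-congˡ-T {col x z =ᶠ s} λ xz≡s →
      sym (Ωj.thinᵇ-col (s-target (toWitness xz≡s)) (s-target xa≡s))

  x₀ a₀ : Fin N
  x₀ = proj₁ (nonempty s)
  a₀ = proj₁ (proj₂ (nonempty s))

  x₀a₀≡s : col x₀ a₀ ≡ s
  x₀a₀≡s = proj₂ (proj₂ (nonempty s))

  k : ℕ
  k = blockDegree x₀ a₀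

  k∣p : k ∣ p
  k∣p = subst (k ∣_) (trans (count-partition (λ z → col x₀ z =ᶠ s) Ωj.block) (out-degree (s-source x₀a₀≡s)))
              (sum-≡0⊎k-divisible _ k λ b → Sum.map₂ (λ (z , h) → in-block-of z b h) (count≡0⊎witness _))
    where
    in-block-of : ∀ z b → T ((col x₀ z =ᶠ s) ∧ (Ωj.block z =ᶠ b)) → count (λ z → (col x₀ z =ᶠ s) ∧ (Ωj.block z =ᶠ b)) ≡ k
    in-block-of z b h with Equivalence.to (T-=ᶠ∧=ᶠ {a = col x₀ z} {s} {Ωj.block z} {b}) h
    ... | x₀z≡s , refl = blockDegree-constant x₀z≡s x₀a₀≡s

  k≡p⇒regular : k ≡ p → Regular s
  k≡p⇒regular k≡p u = ⊆s , s⊆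
    where
    neighbours-in-one-block : ∀ {x a z} → col x a ≡ s → col x z ≡ s → Ωj.block z ≡ Ωj.block a
    neighbours-in-one-block {x} {a} {z} xa≡s xz≡s = proj₂ (Equivalence.to T-=ᶠ∧=ᶠ
      (count-≥⇒⊇ {P = λ z → (col x z =ᶠ s) ∧ (Ωj.block z =ᶠ Ωj.block a)} {Q = λ z → col x z =ᶠ s}
        (λ z h → proj₁ (Equivalence.to (T-∧ {col x z =ᶠ s}) h))
        (≤-reflexive (trans (out-degree (s-source xa≡s)) (sym (trans (blockDegree-constant xa≡s x₀a₀≡s) k≡p))))
        z (fromWitness xz≡s)))
    block-of-neighbours : ∀ {x a z} → col x a ≡ s → col z z ≡ j → Ωj.block z ≡ Ωj.block a → col x z ≡ s
    block-of-neighbours {x} {a} {z} xa≡s zz≡j bz≡ba = toWitness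
      (count-≥⇒⊇ {P = λ z → col x z =ᶠ s} {Q = Ωj.InBlock (Ωj.block a)}
        (λ z xz≡s → Equivalence.from T-=ᶠ∧=ᶠ (s-target (toWitness xz≡s) , neighbours-in-one-block xa≡s (toWitness xz≡s)))
        (≤-reflexive (trans (Ωj.blockSize (Ωj.block a)) (sym (out-degree (s-source xa≡s)))))
        z (Equivalence.from T-=ᶠ∧=ᶠ (zz≡j , bz≡ba)))
    ⊆s : InSSS s u → u ≡ s
    ⊆s (t , (x₁ , y₁ , x₁y₁≡t , z₁ , x₁z₁≡s , z₁y₁≡s*) , (x₂ , y₂ , x₂y₂≡u , z₂ , x₂z₂≡t , z₂y₂≡s)) =
      let w , x₂w≡s , wz₂≡s* = path-transfer (trans x₁y₁≡t (sym x₂z₂≡t)) x₁z₁≡s z₁y₁≡s*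
          by₂≡bw = neighbours-in-one-block (*-elim wz₂≡s*) z₂y₂≡s
      in trans (sym x₂y₂≡u) (block-of-neighbours x₂w≡s (s-target z₂y₂≡s) by₂≡bw)
    s⊆ : u ≡ s → InSSS s u
    s⊆ refl = col x₀ x₀ , (x₀ , x₀ , refl , a₀ , x₀a₀≡s , *-intro x₀a₀≡s) , (x₀ , a₀ , x₀a₀≡s , x₀ , refl , x₀a₀≡s)

  k≡1 : k ≡ 1
  k≡1 with prime⇒irreducible p-prime k∣p
  ... | inj₁ k≡1 = k≡1
  ... | inj₂ k≡p = contradiction (k≡p⇒regular k≡p) s-nonregular

  s-neighbours-distinctBlocks : ∀ {x a a'} → col x a ≡ s → col x a' ≡ s → Ωj.block a ≡ Ωj.block a' → a ≡ a'
  s-neighbours-distinctBlocks {x} {a} {a'} xa≡s xa'≡s ba≡ba' =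
    count≡1⇒unique {P = λ z → (col x z =ᶠ s) ∧ (Ωj.block z =ᶠ Ωj.block a)}
      (trans (blockDegree-constant xa≡s x₀a₀≡s) k≡1)
      (Equivalence.from T-=ᶠ∧=ᶠ (xa≡s , refl)) (Equivalence.from T-=ᶠ∧=ᶠ (xa'≡s , sym ba≡ba'))

  σs·σs* : Fin N → Fin N → ℕ
  σs·σs* = pathCount s (s *)

  σs*·σs : Fin N → Fin N → ℕ
  σs*·σs = pathCount (s *) s

  σs*·σs-outside : ∀ {a b} → ¬ (col a a ≡ j × col b b ≡ j) → σs*·σs a b ≡ 0
  σs*·σs-outside {a} {b} ¬in = count-none {P = λ z → (col a z =ᶠ (s *)) ∧ (col z b =ᶠ s)} λ z h →
    let az≡s* , zb≡s = Equivalence.to T-=ᶠ∧=ᶠ h in ¬in (s-target (*-elim az≡s*) , s-target zb≡s)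

  σs*·σs-diagonal : ∀ {a} → col a a ≡ j → σs*·σs a a ≡ p
  σs*·σs-diagonal {a} aa≡j = trans (pathCount-diagonal* s a) (in-degree aa≡j)

  σs*·σs-sameBlock : ∀ {a b} → col a a ≡ j → col b b ≡ j → a ≢ b → Ωj.block a ≡ Ωj.block b → σs*·σs a b ≡ 0
  σs*·σs-sameBlock {a} {b} _ _ a≢b ba≡bb = count-none {P = λ z → (col a z =ᶠ (s *)) ∧ (col z b =ᶠ s)} λ z h →
    let az≡s* , zb≡s = Equivalence.to T-=ᶠ∧=ᶠ h in a≢b (s-neighbours-distinctBlocks (*-elim az≡s*) zb≡s ba≡bb)

  σs*·σs-otherBlock : ∀ {a b} → col a a ≡ j → col b b ≡ j → Ωj.block a ≢ Ωj.block b → σs*·σs a b ≡ 1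
  σs*·σs-otherBlock {a} {b} aa≡j bb≡j ba≢bb =
    Ωj.count≡1-by-blocks (λ z → col a z =ᶠ (s *)) (λ z b' → col z b' =ᶠ s) constant one-per-block (in-degree aa≡j)
    where
    constant : ∀ {b'} → col b' b' ≡ j → Ωj.block b' ≡ Ωj.block b → σs*·σs a b' ≡ σs*·σs a b
    constant b'b'≡j bb'≡bb = pathCount-constant (s *) s (sym (Ωj.col-otherBlock aa≡j bb≡j b'b'≡j (sym bb'≡bb) ba≢bb))
    one-per-block : ∀ z → T (col a z =ᶠ (s *)) → count (λ b' → Ωj.InBlock (Ωj.block b) b' ∧ (col z b' =ᶠ s)) ≡ 1
    one-per-block z az≡s* = Ωj.transversal (λ b' → col z b' =ᶠ s) (out-degree (s-source (*-elim (toWitness az≡s*))))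
      (λ b' zb'≡s → s-target (toWitness zb'≡s))
      (λ w w' zw≡s zw'≡s → s-neighbours-distinctBlocks (toWitness zw≡s) (toWitness zw'≡s)) (Ωj.block b)

  -- A common neighbour of x and y makes every neighbour of x common (thinness), giving two paths to another one.
  no-common-neighbour : ∀ {x y a} → col x x ≡ i → col y y ≡ i → x ≢ y → Ωi.block x ≡ Ωi.block y →
                        col x a ≡ s → col y a ≡ s → ⊥
  no-common-neighbour {x} {y} {a} xx≡i yy≡i x≢y bx≡by xa≡s ya≡s =
    contradiction (subst (2 ≤_) (σs*·σs-otherBlock (s-target xa≡s) (s-target xb≡s) ba≢bb) two-paths) 1+n≰n
    where
    other-neighbour : Σ[ b ∈ Fin N ] T (col x b =ᶠ s) × b ≢ a
    other-neighbour = count-other (subst (2 ≤_) (sym (out-degree xx≡i)) 2≤p) (fromWitness xa≡s)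
    b : Fin N
    b = proj₁ other-neighbour
    xb≡s : col x b ≡ s
    xb≡s = toWitness (proj₁ (proj₂ other-neighbour))
    ba≢bb : Ωj.block a ≢ Ωj.block b
    ba≢bb ba≡bb = proj₂ (proj₂ other-neighbour) (sym (s-neighbours-distinctBlocks xa≡s xb≡s ba≡bb))
    yb≡s : col y b ≡ s
    yb≡s with path-transfer {z = y} (trans xa≡s (sym xb≡s)) refl ya≡s
    ... | z , xz≡xy , zb≡s = subst (λ w → col w b ≡ s)
            (sym (Ωi.col-sameBlock-injective xx≡i yy≡i (trans (fiberʳ xz≡xy) yy≡i) bx≡by (sym xz≡xy))) zb≡s
    two-paths : 2 ≤ σs*·σs a b
    two-paths = count-≥2 {P = λ z → (col a z =ᶠ (s *)) ∧ (col z b =ᶠ s)}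
      (Equivalence.from T-=ᶠ∧=ᶠ (*-intro xa≡s , xb≡s)) (Equivalence.from T-=ᶠ∧=ᶠ (*-intro ya≡s , yb≡s)) x≢y

  σs·σs*-outside : ∀ {x y} → ¬ (col x x ≡ i × col y y ≡ i) → σs·σs* x y ≡ 0
  σs·σs*-outside {x} {y} ¬in = count-none {P = λ z → (col x z =ᶠ s) ∧ (col z y =ᶠ (s *))} λ z h →
    let xz≡s , zy≡s* = Equivalence.to T-=ᶠ∧=ᶠ h in ¬in (s-source xz≡s , s-source (*-elim zy≡s*))

  σs·σs*-diagonal : ∀ {x} → col x x ≡ i → σs·σs* x x ≡ p
  σs·σs*-diagonal {x} xx≡i = trans (pathCount-diagonal s x) (out-degree xx≡i)

  σs·σs*-sameBlock : ∀ {x y} → col x x ≡ i → col y y ≡ i → x ≢ y → Ωi.block x ≡ Ωi.block y → σs·σs* x y ≡ 0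
  σs·σs*-sameBlock {x} {y} xx≡i yy≡i x≢y bx≡by = count-none {P = λ z → (col x z =ᶠ s) ∧ (col z y =ᶠ (s *))} λ z h →
    let xz≡s , zy≡s* = Equivalence.to T-=ᶠ∧=ᶠ h in no-common-neighbour xx≡i yy≡i x≢y bx≡by xz≡s (*-elim zy≡s*)

  σs·σs*-otherBlock : ∀ {x y} → col x x ≡ i → col y y ≡ i → Ωi.block x ≢ Ωi.block y → σs·σs* x y ≡ 1
  σs·σs*-otherBlock {x} {y} xx≡i yy≡i bx≢by =
    Ωi.count≡1-by-blocks (λ z → col x z =ᶠ s) (λ z y' → col z y' =ᶠ (s *)) constant one-per-block (out-degree xx≡i)
    where
    constant : ∀ {y'} → col y' y' ≡ i → Ωi.block y' ≡ Ωi.block y → σs·σs* x y' ≡ σs·σs* x y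
    constant y'y'≡i by'≡by = pathCount-constant s (s *) (sym (Ωi.col-otherBlock xx≡i yy≡i y'y'≡i (sym by'≡by) bx≢by))
    one-per-block : ∀ z → T (col x z =ᶠ s) → count (λ y' → Ωi.InBlock (Ωi.block y) y' ∧ (col z y' =ᶠ (s *))) ≡ 1
    one-per-block z xz≡s = Ωi.transversal (λ y' → col z y' =ᶠ (s *)) (in-degree (s-target (toWitness xz≡s)))
      (λ y' zy'≡s* → s-source (*-elim (toWitness zy'≡s*)))
      (λ w w' zw≡s* zw'≡s* bw≡bw' → decidable-stable (w ≟ w') λ w≢w' →
         no-common-neighbour (s-source (*-elim (toWitness zw≡s*))) (s-source (*-elim (toWitness zw'≡s*)))
           w≢w' bw≡bw' (*-elim (toWitness zw≡s*)) (*-elim (toWitness zw'≡s*)))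
      (Ωi.block y)

  σs·σs*≡ : ∀ x y → (σ s · σ (s *)) x y ≡ p * σ i x y + σNonThin i x y
  σs·σs*≡ x y = trans (product-pathCount s (s *) x y)
    (Ωi.product-formula σs·σs* σs·σs*-outside σs·σs*-diagonal σs·σs*-sameBlock σs·σs*-otherBlock x y)

  σs*·σs≡ : ∀ x y → (σ (s *) · σ s) x y ≡ p * σ j x y + σNonThin j x y
  σs*·σs≡ x y = trans (product-pathCount (s *) s x y)
    (Ωj.product-formula σs*·σs σs*·σs-outside σs*·σs-diagonal σs*·σs-sameBlock σs*·σs-otherBlock x y)

lemma3p2 : (p : ℕ) → Prime p → {N r : ℕ} → (X : CoherentConfiguration N r) →
    (∀ (d : Fin r) → CC.IsFiber X d → IsoWreath X p d) →
    (i j s : Fin r) → CC.IsFiber X i → CC.IsFiber X j → CC.InS X s i j →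
    ¬ CC.Regular X s → CC.ValencyIs X s i p →
    (∀ x y → CC._·_ X (CC.σ X s) (CC.σ X (CC._* X s)) x y
               ≡ p * CC.σ X i x y + CC.σNonThin X i x y)
    × (∀ x y → CC._·_ X (CC.σ X (CC._* X s)) (CC.σ X s) x y
               ≡ p * CC.σ X j x y + CC.σNonThin X j x y)
lemma3p2 p p-prime X wreath i j s i-fiber j-fiber s∈Sij s-nonregular s-valency =
  σs·σs*≡ , σs*·σs≡
  where open NonRegular p p-prime X wreath i-fiber j-fiber s∈Sij s-nonregular s-valency
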